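{- Let $n\geq 1$ and let $H,G\leq W_n$ be subgroups such that $H$ is elementwise $K_n$-conjugate into $G$, $|H|=|G|$, and $H\cap K_n=\{\mathrm{id}\}$. Then $G\cap K_n=\{\mathrm{id}\}$.
   Context: $T_n$ is the complete binary rooted tree with $n$ levels and $W_n=\mathrm{Aut}(T_n)$. Restriction to the first $n-1$ levels gives a surjection $\pi_n:W_n\to W_{n-1}$, and $K_n=\ker(\pi_n)$ (an elementary abelian $2$-group). For $x,a\in W_n$, $x^a=a^{ -1}xa$. $H$ is elementwise $K_n$-conjugate into $G$ if for every $h\in H$ there exists $a\in K_n$ with $h^a\in G$. -}

module Defs where

open import Data.Nat using (ℕ; zero; suc)
open import Data.Bool using (Bool; true; false; not; _xor_; T)
open import Data.Unit using (⊤; tt)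
open import Data.Product using (Σ; _×_; _,_; ∃-syntax)
open import Function.Bundles using (_↔_)
open import Relation.Binary.PropositionalEquality using (_≡_)

-- W n = Aut(T n), where T n is the complete binary rooted tree whose leaves
-- are at depth n (2^n leaves).  An automorphism is given by its portrait:
-- W 0 is trivial, and an element of W (suc n) is (s , g₀ , g₁) where s says
-- whether the two subtrees at the root are swapped and g₀ , g₁ are the
-- automorphisms induced on the subtrees rooted at the children 0 and 1.
-- Portraits determine automorphisms uniquely, so _≡_ is the right equality.
W : ℕ → Set
W zero = ⊤
W (suc n) = Bool × W n × W n

sel : ∀ {n} → Bool → W n → W n → W n
sel false a b = a
sel true  a b = b

-- vertices/leaves at depth n and the action (right action: x ↦ x ^ g)
Leaf : ℕ → Set
Leaf zero = ⊤
Leaf (suc n) = Bool × Leaf n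

act : ∀ {n} → Leaf n → W n → Leaf n
act {zero} tt tt = tt
act {suc n} (d , w) (s , g₀ , g₁) = (d xor s , act w (sel d g₀ g₁))

-- multiplication: g · h = "first g, then h" (right actions), so that
-- act x (g · h) = act (act x g) h
infixl 7 _·_
_·_ : ∀ {n} → W n → W n → W n
_·_ {zero} tt tt = tt
_·_ {suc n} (s , a₀ , a₁) (t , b₀ , b₁) =
  (s xor t , a₀ · sel s b₀ b₁ , a₁ · sel (not s) b₀ b₁)

e : ∀ {n} → W n
e {zero} = tt
e {suc n} = (false , e , e)

inv : ∀ {n} → W n → W n
inv {zero} tt = tt
inv {suc n} (s , a₀ , a₁) = (s , inv (sel s a₀ a₁) , inv (sel (not s) a₀ a₁))

_^_ : ∀ {n} → W n → W n → W n
x ^ a = inv a · x · a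

-- restriction to the first n levels: π : W (suc n) → W n
π : ∀ {n} → W (suc n) → W n
π {zero} _ = tt
π {suc n} (s , a₀ , a₁) = (s , π a₀ , π a₁)

-- membership in K (suc n) = ker π
InK : ∀ {n} → W (suc n) → Set
InK g = π g ≡ e

record Subgroup (n : ℕ) : Set where
  field
    mem    : W n → Bool
    has-e  : T (mem e)
    closed : ∀ {x y} → T (mem x) → T (mem y) → T (mem (x · y))
    closedInv : ∀ {x} → T (mem x) → T (mem (inv x))

_∈_ : ∀ {n} → W n → Subgroup n → Set
x ∈ H = T (Subgroup.mem H x)

⟦_⟧ : ∀ {n} → Subgroup n → Set
⟦ H ⟧ = Σ (W _) (λ x → x ∈ H)

SameOrder : ∀ {n} → Subgroup n → Subgroup n → Set
SameOrder H G = ⟦ H ⟧ ↔ ⟦ G ⟧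

ElemKConj : ∀ {n} → Subgroup (suc n) → Subgroup (suc n) → Set
ElemKConj H G = ∀ h → h ∈ H → ∃[ a ] (InK a × (h ^ a) ∈ G)

TrivMeetK : ∀ {n} → Subgroup (suc n) → Set
TrivMeetK H = ∀ h → h ∈ H → InK h → h ≡ e

-- The map h ↦ h ^ a_h, where a_h ∈ K is a conjugator sending h into G, does not
-- change the image under π. Since H ∩ K = 1, π is injective on H, hence so is this
-- map H → G; as |H| = |G| are finite, it is onto. So g ∈ G ∩ K is h ^ a for some
-- h ∈ H with π h = π g = 1, i.e. h ∈ H ∩ K, so h = 1 and g = 1 ^ a = 1.
module Submission where

open import Algebra.Bundles using (Group)
open import Algebra.Structures using (IsGroup)
import Algebra.Properties.Group as GroupProperties
open import Data.Bool using (true; false; not)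
import Data.Bool.Properties as Bool
open import Data.Bool.Properties using (T-irrelevant; T?)
open import Data.Fin using (Fin; zero; suc; punchOut)
open import Data.Fin.Properties using (any?; _≟_; punchOut-injective; injective⇒≤)
open import Data.List using (List; []; _∷_; length; lookup; cartesianProduct; deduplicate)
open import Data.List.Membership.Propositional using () renaming (_∈_ to _∈ₗ_)
open import Data.List.Membership.Propositional.Properties using (∈-lookup; ∈-cartesianProduct⁺)
open import Data.List.Relation.Unary.All as All using ()
open import Data.List.Relation.Unary.Any as Any using (here; there)
open import Data.List.Relation.Unary.Any.Properties using (lookup-index)
open import Data.List.Relation.Unary.Enumerates.Setoid using (IsEnumeration)
open import Data.List.Relation.Unary.Enumerates.Setoid.Properties using (deduplicate⁺)
open import Data.List.Relation.Unary.Unique.Propositional using (Unique; _∷_)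
open import Data.List.Relation.Unary.Unique.DecPropositional.Properties using (deduplicate-!)
open import Data.Nat using (ℕ; zero; suc)
open import Data.Nat.Properties using (1+n≰n)
open import Data.Product using (Σ; _,_; proj₁; proj₂)
import Data.Product.Properties as Product
open import Data.Unit using (tt)
open import Function using (_∘_; Inverse; Injection)
open import Function.Properties.Inverse using (↔-sym; ↔⇒↣)
open import Function.Definitions using (Injective; StrictlySurjective)
open import Level using (0ℓ)
open import Relation.Binary.Definitions using (DecidableEquality)
open import Relation.Binary.PropositionalEquality
open import Relation.Binary.PropositionalEquality.Algebra using (isMagma)
open import Relation.Nullary using (yes; no; contradiction)
open import Relation.Unary using (Pred; Decidable; Irrelevant)

open import Defs

fin-injective⇒surjective : ∀ {n} {f : Fin n → Fin n} →
  Injective _≡_ _≡_ f → StrictlySurjective _≡_ f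
fin-injective⇒surjective {suc n} {f} f-injective y with any? (λ x → f x ≟ y)
... | yes fx≡y = fx≡y
... | no ∄x = contradiction (injective⇒≤ f′-injective) 1+n≰n
  where
  f′ : Fin (suc n) → Fin n
  f′ x = punchOut {i = y} (λ y≡fx → ∄x (x , sym y≡fx))

  f′-injective : Injective _≡_ _≡_ f′
  f′-injective = f-injective ∘ punchOut-injective {i = y} _ _

lookup-injective : ∀ {A : Set} {xs : List A} → Unique xs → Injective _≡_ _≡_ (lookup xs)
lookup-injective {xs = _ ∷ _}  (_ ∷ _)   {zero}  {zero}  _  = refl
lookup-injective {xs = _ ∷ xs} (x∉ ∷ _)  {zero}  {suc j} eq =
  contradiction eq (All.lookup x∉ (∈-lookup {xs = xs} j))
lookup-injective {xs = _ ∷ xs} (x∉ ∷ _)  {suc i} {zero}  eq =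
  contradiction (sym eq) (All.lookup x∉ (∈-lookup {xs = xs} i))
lookup-injective {xs = _ ∷ _}  (_ ∷ xs!) {suc i} {suc j} eq = cong suc (lookup-injective xs! eq)

module _ {A : Set} (_≟ᴬ_ : DecidableEquality A) {xs : List A}
         (xs-enumerates : IsEnumeration (setoid A) xs) where

  private
    ys : List A
    ys = deduplicate _≟ᴬ_ xs

    ys-enumerates : IsEnumeration (setoid A) ys
    ys-enumerates = deduplicate⁺ (decSetoid _≟ᴬ_) xs-enumerates

    ι : A → Fin (length ys)
    ι x = Any.index (ys-enumerates x)

    ι-injective : Injective _≡_ _≡_ ι
    ι-injective {x} {y} ιx≡ιy = begin
      x                ≡⟨ lookup-index (ys-enumerates x) ⟩
      lookup ys (ι x)  ≡⟨ cong (lookup ys) ιx≡ιy ⟩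
      lookup ys (ι y)  ≡⟨ lookup-index (ys-enumerates y) ⟨
      y                ∎
      where open ≡-Reasoning

  -- Without duplicates, lookup is a bijection onto A and ι its inverse, so ι ∘ f ∘ lookup
  -- is an injective endomap of Fin (length ys).
  injective⇒surjective : ∀ {f : A → A} → Injective _≡_ _≡_ f → StrictlySurjective _≡_ f
  injective⇒surjective {f} f-injective y
    with i , ι[f[ys!i]]≡ιy ← fin-injective⇒surjective
           (lookup-injective (deduplicate-! _≟ᴬ_ xs) ∘ f-injective ∘ ι-injective) (ι y)
    = lookup ys i , ι-injective ι[f[ys!i]]≡ιy

module _ {A : Set} {P : Pred A 0ℓ} (P? : Decidable P) where

  witnesses : List A → List (Σ A P)
  witnesses [] = []
  witnesses (x ∷ xs) with P? x
  ... | yes px = (x , px) ∷ witnesses xs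
  ... | no _   = witnesses xs

  witnesses-isEnumeration : Irrelevant P → ∀ {xs} → IsEnumeration (setoid A) xs →
                            IsEnumeration (setoid (Σ A P)) (witnesses xs)
  witnesses-isEnumeration P-irrelevant {xs} xs-enumerates (x , px) = go xs (xs-enumerates x)
    where
    go : ∀ ys → x ∈ₗ ys → (x , px) ∈ₗ witnesses ys
    go (y ∷ ys) x∈y∷ys with P? y | x∈y∷ys
    ... | yes py | here refl = here (cong (x ,_) (P-irrelevant px py))
    ... | yes _  | there x∈ys = there (go ys x∈ys)
    ... | no ¬py | here refl = contradiction px ¬py
    ... | no _   | there x∈ys = go ys x∈ys

·-assoc : ∀ {n} (a b c : W n) → (a · b) · c ≡ a · (b · c)
·-assoc {zero} a b c = refl
·-assoc {suc n} (false , a₀ , a₁) (false , b₀ , b₁) (u , c₀ , c₁) =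
  cong₂ (λ x y → (u , x , y)) (·-assoc a₀ b₀ _) (·-assoc a₁ b₁ _)
·-assoc {suc n} (false , a₀ , a₁) (true , b₀ , b₁) (u , c₀ , c₁) =
  cong₂ (λ x y → (not u , x , y)) (·-assoc a₀ b₀ _) (·-assoc a₁ b₁ _)
·-assoc {suc n} (true , a₀ , a₁) (false , b₀ , b₁) (u , c₀ , c₁) =
  cong₂ (λ x y → (not u , x , y)) (·-assoc a₀ b₁ _) (·-assoc a₁ b₀ _)
·-assoc {suc n} (true , a₀ , a₁) (true , b₀ , b₁) (false , c₀ , c₁) =
  cong₂ (λ x y → (false , x , y)) (·-assoc a₀ b₁ _) (·-assoc a₁ b₀ _)
·-assoc {suc n} (true , a₀ , a₁) (true , b₀ , b₁) (true , c₀ , c₁) =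
  cong₂ (λ x y → (true , x , y)) (·-assoc a₀ b₁ _) (·-assoc a₁ b₀ _)

·-identityˡ : ∀ {n} (a : W n) → e · a ≡ a
·-identityˡ {zero} a = refl
·-identityˡ {suc n} (s , a₀ , a₁) = cong₂ (λ x y → (s , x , y)) (·-identityˡ a₀) (·-identityˡ a₁)

·-identityʳ : ∀ {n} (a : W n) → a · e ≡ a
·-identityʳ {zero} a = refl
·-identityʳ {suc n} (false , a₀ , a₁) =
  cong₂ (λ x y → (false , x , y)) (·-identityʳ a₀) (·-identityʳ a₁)
·-identityʳ {suc n} (true , a₀ , a₁) =
  cong₂ (λ x y → (true , x , y)) (·-identityʳ a₀) (·-identityʳ a₁)

·-inverseˡ : ∀ {n} (a : W n) → inv a · a ≡ e
·-inverseˡ {zero} a = refl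
·-inverseˡ {suc n} (false , a₀ , a₁) =
  cong₂ (λ x y → (false , x , y)) (·-inverseˡ a₀) (·-inverseˡ a₁)
·-inverseˡ {suc n} (true , a₀ , a₁) =
  cong₂ (λ x y → (false , x , y)) (·-inverseˡ a₁) (·-inverseˡ a₀)

·-inverseʳ : ∀ {n} (a : W n) → a · inv a ≡ e
·-inverseʳ {zero} a = refl
·-inverseʳ {suc n} (false , a₀ , a₁) =
  cong₂ (λ x y → (false , x , y)) (·-inverseʳ a₀) (·-inverseʳ a₁)
·-inverseʳ {suc n} (true , a₀ , a₁) =
  cong₂ (λ x y → (false , x , y)) (·-inverseʳ a₀) (·-inverseʳ a₁)

W-isGroup : ∀ n → IsGroup _≡_ (_·_ {n}) e inv
W-isGroup n = record
  { isMonoid = record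
    { isSemigroup = record { isMagma = isMagma _·_ ; assoc = ·-assoc }
    ; identity    = ·-identityˡ , ·-identityʳ
    }
  ; inverse  = ·-inverseˡ , ·-inverseʳ
  ; ⁻¹-cong  = cong inv
  }

W-group : ℕ → Group 0ℓ 0ℓ
W-group n = record { isGroup = W-isGroup n }

π-· : ∀ {n} (a b : W (suc n)) → π (a · b) ≡ π a · π b
π-· {zero} a b = refl
π-· {suc n} (false , a₀ , a₁) (t , b₀ , b₁) = cong₂ (λ x y → (t , x , y)) (π-· a₀ b₀) (π-· a₁ b₁)
π-· {suc n} (true , a₀ , a₁) (t , b₀ , b₁) = cong₂ (λ x y → (not t , x , y)) (π-· a₀ b₁) (π-· a₁ b₀)

π-inv : ∀ {n} (a : W (suc n)) → π (inv a) ≡ inv (π a)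
π-inv {zero} a = refl
π-inv {suc n} (false , a₀ , a₁) = cong₂ (λ x y → (false , x , y)) (π-inv a₀) (π-inv a₁)
π-inv {suc n} (true , a₀ , a₁) = cong₂ (λ x y → (true , x , y)) (π-inv a₁) (π-inv a₀)

π-^ : ∀ {n} (h a : W (suc n)) → InK a → π (h ^ a) ≡ π h
π-^ {n} h a πa≡e = begin
  π (inv a · h · a)      ≡⟨ π-· (inv a · h) a ⟩
  π (inv a · h) · π a    ≡⟨ cong₂ _·_ (π-· (inv a) h) πa≡e ⟩
  π (inv a) · π h · e    ≡⟨ ·-identityʳ _ ⟩
  π (inv a) · π h        ≡⟨ cong (_· π h) (trans (π-inv a) (cong inv πa≡e)) ⟩
  inv e · π h            ≡⟨ cong (_· π h) (ε⁻¹≈ε) ⟩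
  e · π h                ≡⟨ ·-identityˡ (π h) ⟩
  π h                    ∎
  where
  open ≡-Reasoning
  open GroupProperties (W-group n) using (ε⁻¹≈ε)

e-^ : ∀ {n} (a : W n) → e ^ a ≡ e
e-^ a = trans (cong (_· a) (·-identityʳ (inv a))) (·-inverseˡ a)

TrivMeetK⇒π-injective : ∀ {n} (H : Subgroup (suc n)) → TrivMeetK H →
  ∀ {x y} → x ∈ H → y ∈ H → π x ≡ π y → x ≡ y
TrivMeetK⇒π-injective {n} H trivH {x} {y} x∈H y∈H πx≡πy =
  x∙y⁻¹≈ε⇒x≈y x y (trivH (x · inv y) x·y⁻¹∈H (begin
    π (x · inv y)       ≡⟨ π-· x (inv y) ⟩
    π x · π (inv y)     ≡⟨ cong₂ _·_ πx≡πy (π-inv y) ⟩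
    π y · inv (π y)     ≡⟨ ·-inverseʳ (π y) ⟩
    e                   ∎))
  where
  open ≡-Reasoning
  open GroupProperties (W-group (suc n)) using (x∙y⁻¹≈ε⇒x≈y)
  x·y⁻¹∈H = Subgroup.closed H x∈H (Subgroup.closedInv H y∈H)

_≟W_ : ∀ {n} → DecidableEquality (W n)
_≟W_ {zero} tt tt = yes refl
_≟W_ {suc n} = Product.≡-dec Bool._≟_ (Product.≡-dec _≟W_ _≟W_)

allW : ∀ n → List (W n)
allW zero = tt ∷ []
allW (suc n) = cartesianProduct (false ∷ true ∷ []) (cartesianProduct (allW n) (allW n))

allW-isEnumeration : ∀ n → IsEnumeration (setoid (W n)) (allW n)
allW-isEnumeration zero tt = here refl
allW-isEnumeration (suc n) (s , a₀ , a₁) =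
  ∈-cartesianProduct⁺ (bools s) (∈-cartesianProduct⁺ (allW-isEnumeration n a₀) (allW-isEnumeration n a₁))
  where
  bools : ∀ b → b ∈ₗ false ∷ true ∷ []
  bools false = here refl
  bools true  = there (here refl)

module _ {n} (G : Subgroup n) where

  _≟⟦⟧_ : DecidableEquality ⟦ G ⟧
  _≟⟦⟧_ = Product.≡-dec _≟W_ (λ p q → yes (T-irrelevant p q))

  subgroup-injective⇒surjective : ∀ {f : ⟦ G ⟧ → ⟦ G ⟧} →
    Injective _≡_ _≡_ f → StrictlySurjective _≡_ f
  subgroup-injective⇒surjective = injective⇒surjective _≟⟦⟧_
    (witnesses-isEnumeration (T? ∘ Subgroup.mem G) T-irrelevant (allW-isEnumeration n))

module KConjugation {n} {H G : Subgroup (suc n)} (conj : ElemKConj H G) where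

  conjugateInto : ⟦ H ⟧ → ⟦ G ⟧
  conjugateInto (h , h∈H) = let a , _ , h^a∈G = conj h h∈H in h ^ a , h^a∈G

  π-conjugateInto : ∀ x → π (proj₁ (conjugateInto x)) ≡ π (proj₁ x)
  π-conjugateInto (h , h∈H) = let a , a∈K , _ = conj h h∈H in π-^ h a a∈K

  conjugateInto-e : ∀ x → proj₁ x ≡ e → proj₁ (conjugateInto x) ≡ e
  conjugateInto-e (h , h∈H) refl = e-^ (proj₁ (conj h h∈H))

  conjugateInto-injective : TrivMeetK H → Injective _≡_ _≡_ conjugateInto
  conjugateInto-injective trivH {h , h∈H} {h′ , h′∈H} eq =
    Product.Σ-≡,≡→≡ (TrivMeetK⇒π-injective H trivH h∈H h′∈H (begin
      π h                             ≡⟨ π-conjugateInto (h , h∈H) ⟨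
      π (proj₁ (conjugateInto _))     ≡⟨ cong (π ∘ proj₁) eq ⟩
      π (proj₁ (conjugateInto _))     ≡⟨ π-conjugateInto (h′ , h′∈H) ⟩
      π h′                            ∎) , T-irrelevant _ _)
    where open ≡-Reasoning

  conjugateInto-surjective : TrivMeetK H → SameOrder H G → StrictlySurjective _≡_ conjugateInto
  conjugateInto-surjective trivH iso y =
    let x , x↦y = subgroup-injective⇒surjective G {conjugateInto ∘ from}
                                        (from-injective ∘ conjugateInto-injective trivH) y
    in from x , x↦y
    where
    open Inverse iso using (from)

    from-injective : Injective _≡_ _≡_ from
    from-injective = Injection.injective (↔⇒↣ (↔-sym iso))

lemma4p1 : (m : ℕ) (H G : Subgroup (suc m)) →
    ElemKConj H G → SameOrder H G → TrivMeetK H → TrivMeetK G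
lemma4p1 m H G conj iso trivH g g∈G πg≡e = begin
  g                          ≡⟨ cong proj₁ x↦g ⟨
  proj₁ (conjugateInto x)    ≡⟨ conjugateInto-e x (trivH (proj₁ x) (proj₂ x) πx≡e) ⟩
  e                          ∎
  where
  open ≡-Reasoning
  open KConjugation {H = H} {G = G} conj

  preimage : Σ ⟦ H ⟧ (λ x → conjugateInto x ≡ (g , g∈G))
  preimage = conjugateInto-surjective trivH iso (g , g∈G)

  x : ⟦ H ⟧
  x = proj₁ preimage

  x↦g : conjugateInto x ≡ (g , g∈G)
  x↦g = proj₂ preimage

  πx≡e : π (proj₁ x) ≡ e
  πx≡e = trans (sym (π-conjugateInto x)) (trans (cong (π ∘ proj₁) x↦g) πg≡e)
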